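{- Let $n$ be a positive integer and $1\le k\le \frac{n}{2}$. Then $\mathrm{rc}(J(n,k))=k-1=\mathrm{rad}(J(n,k))-1$.
   Context: The Johnson graph $J(n,k)$ has as vertices the $k$-element subsets of an $n$-element set, two vertices $A,B$ being adjacent iff $|A\cap B|=k-1$. Cop and robber game with radius of capture $r$: first the cop chooses a vertex, then the robber; afterwards, starting with the cop, the players alternately either move to an adjacent vertex or stay put, both knowing both positions. The cop wins if at some point the distance between the players is at most $r$. $\mathcal{CWRC}(r)$ is the class of graphs on which the cop has a winning strategy. $\mathrm{rc}(G)=\min\{r\in\mathbb{N}_0 \mid G\in\mathcal{CWRC}(r)\}$. $\mathrm{rad}$ denotes the radius. -}

module Defs where

open import Data.Nat using (ℕ; zero; suc; _≤_; _∸_)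
open import Data.Fin.Subset using (Subset; ∣_∣; _∩_)
open import Data.Product using (Σ; ∃; _×_; _,_; proj₁)
open import Data.Sum using (_⊎_)
open import Relation.Binary.PropositionalEquality using (_≡_)
open import Relation.Nullary using (¬_)

record Graph : Set₁ where
  field
    V   : Set
    Adj : V → V → Set
open Graph public

data Within (G : Graph) : ℕ → V G → V G → Set where
  here : ∀ {r u} → Within G r u u
  step : ∀ {r u w v} → Adj G u w → Within G r w v → Within G (suc r) u v

Move : (G : Graph) → V G → V G → Set
Move G u v = v ≡ u ⊎ Adj G u v

-- CopWins G r c x : it is the cop's turn, the cop is at c, the robber at x,
-- and the cop has a strategy guaranteeing that the distance becomes ≤ r
-- after finitely many moves (inductive = well-founded strategy tree).
data CopWins (G : Graph) (r : ℕ) (c x : V G) : Set where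
  caught : Within G r c x → CopWins G r c x
  play   : (c' : V G) → Move G c c' →
           (Within G r c' x ⊎ ((x' : V G) → Move G x x' → CopWins G r c' x')) →
           CopWins G r c x

-- G ∈ CWRC(r): the cop chooses a start vertex, then the robber chooses one,
-- and the cop wins from there (cop moving first).
CWRC : ℕ → Graph → Set
CWRC r G = Σ (V G) λ c → (x : V G) → CopWins G r c x

IsRc : Graph → ℕ → Set
IsRc G m = CWRC m G × ((r : ℕ) → CWRC r G → m ≤ r)

EccLe : (G : Graph) → V G → ℕ → Set
EccLe G v r = (u : V G) → Within G r v u

IsRadius : Graph → ℕ → Set
IsRadius G ρ = Σ (V G) (λ v → EccLe G v ρ) × ((r : ℕ) (v : V G) → EccLe G v r → ρ ≤ r)

Johnson : ℕ → ℕ → Graph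
Johnson n k = record
  { V   = Σ (Subset n) (λ A → ∣ A ∣ ≡ k)
  ; Adj = λ A B → ∣ proj₁ A ∩ proj₁ B ∣ ≡ k ∸ 1
  }

module Submission where

-- In J(n,k) the distance between A and B is k − |A ∩ B|: along an edge |A ∩ X| grows by at most
-- one, and exchanging an element of A ∖ B for one of B ∖ A makes it grow by exactly one.  Hence
-- every eccentricity is at most k, and a cop anywhere catches with radius k − 1 by stepping
-- towards the robber.  Conversely, since 2k ≤ n, a set X meeting C can exchange a shared element
-- for one outside X ∪ C, so some vertex is disjoint from C: eccentricities are exactly k.  Against
-- radius r ≤ k − 2 the robber stays disjoint from the cop forever, because after a cop move they
-- share at most one element, which the robber exchanges away.

open import Defs
open import Data.Nat using (ℕ; _≤_; _<_; _*_; _+_; _∸_; zero; suc; s≤s; z<s)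
open import Data.Nat.Properties
open import Data.Bool using (_∧_)
open import Data.Fin using (Fin; zero; suc)
open import Data.Fin.Subset
  using (Subset; ∣_∣; _∩_; _∪_; _─_; _-_; ⁅_⁆; _∈_; _∉_; _⊆_; ⊥; ⊤; inside; outside)
open import Data.Fin.Subset.Properties
  using ( ∣⊥∣≡0; ∣⊤∣≡n; ∈⊤; ∩-comm; ∩-idem; ∩-zeroˡ; ∩-zeroʳ; ∩-identityˡ; ∩-identityʳ; ∪-identityˡ
        ; ∣p∩q∣≤∣p∣; p∩q⊆p; x∈p∩q⁻; x∈p∪q⁺; p─⊥≡p; p─q⊆p; p⊂q⇒∣p∣<∣q∣; ⊆-antisym; _∈?_ )
open import Data.Vec using ([]; _∷_; here; there)
open import Data.Product using (_×_; _,_; proj₁; proj₂; ∃)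
import Data.Product as Product
open import Data.Product.Properties using (Σ-≡,≡→≡)
open import Data.Sum using (inj₁; inj₂)
open import Function using (_∘_)
open import Relation.Nullary using (¬_; yes; no; contradiction)
open import Relation.Binary.PropositionalEquality
open import Algebra.Properties.CommutativeSemigroup +-commutativeSemigroup using (xy∙z≈xz∙y)

module _ {G : Graph} {r : ℕ} where

  Within-suc⇒CopWins : ∀ {c x} → Within G (suc r) c x → CopWins G r c x
  Within-suc⇒CopWins here           = caught here
  Within-suc⇒CopWins (step c~w w~x) = play _ (inj₂ c~w) (inj₁ w~x)

  EccLe-suc⇒CWRC : ∀ {c} → EccLe G c (suc r) → CWRC r G
  EccLe-suc⇒CWRC {c} ecc = c , λ x → Within-suc⇒CopWins (ecc x)

  module _ (Safe : V G → V G → Set)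
           (safe⇒far : ∀ {c x c′} → Safe c x → Move G c c′ → ¬ Within G r c′ x)
           (safe-reply : ∀ {c x c′} → Safe c x → Move G c c′ →
                         ∃ λ x′ → Move G x x′ × Safe c′ x′)
           where

    Safe⇒¬CopWins : ∀ {c x} → Safe c x → ¬ CopWins G r c x
    Safe⇒¬CopWins s (caught c~x)              = safe⇒far s (inj₁ refl) c~x
    Safe⇒¬CopWins s (play _ c→c′ (inj₁ c′~x)) = safe⇒far s c→c′ c′~x
    Safe⇒¬CopWins s (play _ c→c′ (inj₂ win))  =
      let x′ , x→x′ , s′ = safe-reply s c→c′ in Safe⇒¬CopWins s′ (win x′ x→x′)

private
  variable
    n : ℕ
    p q : Subset n
    x y : Fin n

∣s∷p∣+m≡∣s∷q∣ : ∀ s (p q : Subset n) {m} → ∣ p ∣ + m ≡ ∣ q ∣ → ∣ s ∷ p ∣ + m ≡ ∣ s ∷ q ∣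
∣s∷p∣+m≡∣s∷q∣ inside  _ _ e = cong suc e
∣s∷p∣+m≡∣s∷q∣ outside _ _ e = e

∣⊥∩p∣≡0 : ∀ (p : Subset n) → ∣ ⊥ ∩ p ∣ ≡ 0
∣⊥∩p∣≡0 {n} p = trans (cong ∣_∣ (∩-zeroˡ p)) (∣⊥∣≡0 n)

∣⁅x⁆∩p∣≡1 : x ∈ p → ∣ ⁅ x ⁆ ∩ p ∣ ≡ 1
∣⁅x⁆∩p∣≡1 {p = _ ∷ p} here = cong suc (∣⊥∩p∣≡0 p)
∣⁅x⁆∩p∣≡1 (there x∈p)      = ∣⁅x⁆∩p∣≡1 x∈p

∣⁅x⁆∩p∣≡0 : x ∉ p → ∣ ⁅ x ⁆ ∩ p ∣ ≡ 0
∣⁅x⁆∩p∣≡0 {x = zero}  {p = inside  ∷ p} x∉p = contradiction here x∉p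
∣⁅x⁆∩p∣≡0 {x = zero}  {p = outside ∷ p} _   = ∣⊥∩p∣≡0 p
∣⁅x⁆∩p∣≡0 {x = suc x} {p = _ ∷ p}       x∉p = ∣⁅x⁆∩p∣≡0 (x∉p ∘ there)

∣p-x∩q∣+∣⁅x⁆∩q∣≡∣p∩q∣ : x ∈ p → ∀ q → ∣ (p - x) ∩ q ∣ + ∣ ⁅ x ⁆ ∩ q ∣ ≡ ∣ p ∩ q ∣
∣p-x∩q∣+∣⁅x⁆∩q∣≡∣p∩q∣ {p = _ ∷ p} here (t ∷ q) =
  trans (+-comm ∣ (p ─ ⊥) ∩ q ∣ _)
        (∣s∷p∣+m≡∣s∷q∣ t (⊥ ∩ q) (p ∩ q)
          (cong₂ _+_ (∣⊥∩p∣≡0 q) (cong (λ p′ → ∣ p′ ∩ q ∣) (p─⊥≡p p))))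
∣p-x∩q∣+∣⁅x⁆∩q∣≡∣p∩q∣ {p = s ∷ p} (there x∈p) (t ∷ q) =
  ∣s∷p∣+m≡∣s∷q∣ (s ∧ t) ((p - _) ∩ q) (p ∩ q) (∣p-x∩q∣+∣⁅x⁆∩q∣≡∣p∩q∣ x∈p q)

∣⁅x⁆∪p∩q∣≡∣p∩q∣+∣⁅x⁆∩q∣ : x ∉ p → ∀ q → ∣ (⁅ x ⁆ ∪ p) ∩ q ∣ ≡ ∣ p ∩ q ∣ + ∣ ⁅ x ⁆ ∩ q ∣
∣⁅x⁆∪p∩q∣≡∣p∩q∣+∣⁅x⁆∩q∣ {x = zero} {p = inside ∷ p} x∉p _ = contradiction here x∉p
∣⁅x⁆∪p∩q∣≡∣p∩q∣+∣⁅x⁆∩q∣ {x = zero} {p = outside ∷ p} _ (t ∷ q) =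
  sym (trans (+-comm ∣ p ∩ q ∣ _)
             (∣s∷p∣+m≡∣s∷q∣ t (⊥ ∩ q) ((⊥ ∪ p) ∩ q)
               (cong₂ _+_ (∣⊥∩p∣≡0 q) (cong (λ p′ → ∣ p′ ∩ q ∣) (sym (∪-identityˡ p))))))
∣⁅x⁆∪p∩q∣≡∣p∩q∣+∣⁅x⁆∩q∣ {x = suc x} {p = s ∷ p} x∉p (t ∷ q) =
  sym (∣s∷p∣+m≡∣s∷q∣ (s ∧ t) (p ∩ q) ((⁅ x ⁆ ∪ p) ∩ q)
        (sym (∣⁅x⁆∪p∩q∣≡∣p∩q∣+∣⁅x⁆∩q∣ (x∉p ∘ there) q)))

exchange : Subset n → Fin n → Fin n → Subset n
exchange p x y = ⁅ y ⁆ ∪ (p - x)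

∣exchange∩q∣ : x ∈ p → y ∉ p → ∀ q →
  ∣ exchange p x y ∩ q ∣ + ∣ ⁅ x ⁆ ∩ q ∣ ≡ ∣ p ∩ q ∣ + ∣ ⁅ y ⁆ ∩ q ∣
∣exchange∩q∣ {x = x} {p = p} {y = y} x∈p y∉p q = begin
  ∣ exchange p x y ∩ q ∣ + ∣ ⁅ x ⁆ ∩ q ∣
    ≡⟨ cong (_+ ∣ ⁅ x ⁆ ∩ q ∣) (∣⁅x⁆∪p∩q∣≡∣p∩q∣+∣⁅x⁆∩q∣ (y∉p ∘ p─q⊆p p ⁅ x ⁆) q) ⟩
  ∣ (p - x) ∩ q ∣ + ∣ ⁅ y ⁆ ∩ q ∣ + ∣ ⁅ x ⁆ ∩ q ∣
    ≡⟨ xy∙z≈xz∙y ∣ (p - x) ∩ q ∣ _ _ ⟩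
  ∣ (p - x) ∩ q ∣ + ∣ ⁅ x ⁆ ∩ q ∣ + ∣ ⁅ y ⁆ ∩ q ∣
    ≡⟨ cong (_+ ∣ ⁅ y ⁆ ∩ q ∣) (∣p-x∩q∣+∣⁅x⁆∩q∣≡∣p∩q∣ x∈p q) ⟩
  ∣ p ∩ q ∣ + ∣ ⁅ y ⁆ ∩ q ∣ ∎
  where open ≡-Reasoning

∣exchange∣ : x ∈ p → y ∉ p → ∣ exchange p x y ∣ ≡ ∣ p ∣
∣exchange∣ {x = x} {p = p} {y = y} x∈p y∉p = +-cancelʳ-≡ 1 _ _ (begin
  ∣ exchange p x y ∣ + 1
    ≡⟨ cong₂ _+_ (∣r∩⊤∣≡∣r∣ (exchange p x y)) (∣⁅x⁆∩p∣≡1 {x = x} ∈⊤) ⟨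
  ∣ exchange p x y ∩ ⊤ ∣ + ∣ ⁅ x ⁆ ∩ ⊤ ∣
    ≡⟨ ∣exchange∩q∣ x∈p y∉p ⊤ ⟩
  ∣ p ∩ ⊤ ∣ + ∣ ⁅ y ⁆ ∩ ⊤ ∣
    ≡⟨ cong₂ _+_ (∣r∩⊤∣≡∣r∣ p) (∣⁅x⁆∩p∣≡1 {x = y} ∈⊤) ⟩
  ∣ p ∣ + 1 ∎)
  where
  open ≡-Reasoning
  ∣r∩⊤∣≡∣r∣ : ∀ r → ∣ r ∩ ⊤ ∣ ≡ ∣ r ∣
  ∣r∩⊤∣≡∣r∣ r = cong ∣_∣ (∩-identityʳ r)

∣p∪q∣+∣p∩q∣≡∣p∣+∣q∣ : ∀ (p q : Subset n) → ∣ p ∪ q ∣ + ∣ p ∩ q ∣ ≡ ∣ p ∣ + ∣ q ∣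
∣p∪q∣+∣p∩q∣≡∣p∣+∣q∣ []            []            = refl
∣p∪q∣+∣p∩q∣≡∣p∣+∣q∣ (inside  ∷ p) (inside  ∷ q) =
  cong suc (trans (+-suc ∣ p ∪ q ∣ _)
                  (trans (cong suc (∣p∪q∣+∣p∩q∣≡∣p∣+∣q∣ p q)) (sym (+-suc ∣ p ∣ _))))
∣p∪q∣+∣p∩q∣≡∣p∣+∣q∣ (inside  ∷ p) (outside ∷ q) = cong suc (∣p∪q∣+∣p∩q∣≡∣p∣+∣q∣ p q)
∣p∪q∣+∣p∩q∣≡∣p∣+∣q∣ (outside ∷ p) (inside  ∷ q) =
  trans (cong suc (∣p∪q∣+∣p∩q∣≡∣p∣+∣q∣ p q)) (sym (+-suc ∣ p ∣ _))
∣p∪q∣+∣p∩q∣≡∣p∣+∣q∣ (outside ∷ p) (outside ∷ q) = ∣p∪q∣+∣p∩q∣≡∣p∣+∣q∣ p q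

+-suc-mono-≤ : ∀ {a b c d} → a + b ≤ c + d → a + suc b ≤ c + suc d
+-suc-mono-≤ {a} {b} {c} {d} h = subst₂ _≤_ (sym (+-suc a b)) (sym (+-suc c d)) (s≤s h)

∣q∩r∣+∣p∩q∣≤∣p∩r∣+∣q∣ : ∀ (p q r : Subset n) → ∣ q ∩ r ∣ + ∣ p ∩ q ∣ ≤ ∣ p ∩ r ∣ + ∣ q ∣
∣q∩r∣+∣p∩q∣≤∣p∩r∣+∣q∣ []            []            []            = ≤-refl
∣q∩r∣+∣p∩q∣≤∣p∩r∣+∣q∣ (inside  ∷ p) (inside  ∷ q) (inside  ∷ r) =
  s≤s (+-suc-mono-≤ (∣q∩r∣+∣p∩q∣≤∣p∩r∣+∣q∣ p q r))
∣q∩r∣+∣p∩q∣≤∣p∩r∣+∣q∣ (inside  ∷ p) (inside  ∷ q) (outside ∷ r) =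
  +-suc-mono-≤ (∣q∩r∣+∣p∩q∣≤∣p∩r∣+∣q∣ p q r)
∣q∩r∣+∣p∩q∣≤∣p∩r∣+∣q∣ (outside ∷ p) (inside  ∷ q) (inside  ∷ r) =
  ≤-trans (s≤s (∣q∩r∣+∣p∩q∣≤∣p∩r∣+∣q∣ p q r)) (≤-reflexive (sym (+-suc ∣ p ∩ r ∣ _)))
∣q∩r∣+∣p∩q∣≤∣p∩r∣+∣q∣ (outside ∷ p) (inside  ∷ q) (outside ∷ r) =
  ≤-trans (∣q∩r∣+∣p∩q∣≤∣p∩r∣+∣q∣ p q r) (+-monoʳ-≤ ∣ p ∩ r ∣ (n≤1+n ∣ q ∣))
∣q∩r∣+∣p∩q∣≤∣p∩r∣+∣q∣ (inside  ∷ p) (outside ∷ q) (inside  ∷ r) =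
  m≤n⇒m≤1+n (∣q∩r∣+∣p∩q∣≤∣p∩r∣+∣q∣ p q r)
∣q∩r∣+∣p∩q∣≤∣p∩r∣+∣q∣ (inside  ∷ p) (outside ∷ q) (outside ∷ r) = ∣q∩r∣+∣p∩q∣≤∣p∩r∣+∣q∣ p q r
∣q∩r∣+∣p∩q∣≤∣p∩r∣+∣q∣ (outside ∷ p) (outside ∷ q) (_       ∷ r) = ∣q∩r∣+∣p∩q∣≤∣p∩r∣+∣q∣ p q r

∃x∈p∧x∉q-there : ∀ {s t} → (∃ λ x → x ∈ p × x ∉ q) → ∃ λ x → x ∈ s ∷ p × x ∉ t ∷ q
∃x∈p∧x∉q-there (x , x∈p , x∉q) = suc x , there x∈p , λ { (there x∈q) → x∉q x∈q }

∣p∩q∣<∣p∣⇒∃x∈p∧x∉q : ∀ (p q : Subset n) → ∣ p ∩ q ∣ < ∣ p ∣ → ∃ λ x → x ∈ p × x ∉ q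
∣p∩q∣<∣p∣⇒∃x∈p∧x∉q (inside  ∷ p) (outside ∷ q) _ = zero , here , λ ()
∣p∩q∣<∣p∣⇒∃x∈p∧x∉q (inside  ∷ p) (inside  ∷ q) (s≤s lt) = ∃x∈p∧x∉q-there (∣p∩q∣<∣p∣⇒∃x∈p∧x∉q p q lt)
∣p∩q∣<∣p∣⇒∃x∈p∧x∉q (outside ∷ p) (_       ∷ q) lt       = ∃x∈p∧x∉q-there (∣p∩q∣<∣p∣⇒∃x∈p∧x∉q p q lt)

0<∣p∩q∣⇒∃x∈p∧x∈q : ∀ (p q : Subset n) → 0 < ∣ p ∩ q ∣ → ∃ λ x → x ∈ p × x ∈ q
0<∣p∩q∣⇒∃x∈p∧x∈q {n} p q 0<∣p∩q∣ = Product.map₂ (x∈p∩q⁻ p q ∘ proj₁)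
  (∣p∩q∣<∣p∣⇒∃x∈p∧x∉q (p ∩ q) ⊥
    (subst (_< ∣ p ∩ q ∣) (sym (trans (cong ∣_∣ (∩-zeroʳ (p ∩ q))) (∣⊥∣≡0 n))) 0<∣p∩q∣))

∣p∣<n⇒∃x∉p : ∀ (p : Subset n) → ∣ p ∣ < n → ∃ λ x → x ∉ p
∣p∣<n⇒∃x∉p {n} p ∣p∣<n = Product.map₂ proj₂
  (∣p∩q∣<∣p∣⇒∃x∈p∧x∉q ⊤ p (subst₂ _<_ (sym (cong ∣_∣ (∩-identityˡ p))) (sym (∣⊤∣≡n n)) ∣p∣<n))

∣p∩q∣≡∣p∣⇒p⊆q : ∣ p ∩ q ∣ ≡ ∣ p ∣ → p ⊆ q
∣p∩q∣≡∣p∣⇒p⊆q {p = p} {q = q} e {x} x∈p with x ∈? q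
... | yes x∈q = x∈q
... | no  x∉q = contradiction e (<⇒≢ (p⊂q⇒∣p∣<∣q∣ (p∩q⊆p p q , x , x∈p , x∉q ∘ proj₂ ∘ x∈p∩q⁻ p q)))

∃∣p∣≡k : ∀ {n k} → k ≤ n → ∃ λ (p : Subset n) → ∣ p ∣ ≡ k
∃∣p∣≡k {n} {zero}  _         = ⊥ , ∣⊥∣≡0 n
∃∣p∣≡k {suc n} {suc k} (s≤s k≤n) = Product.map (inside ∷_) (cong suc) (∃∣p∣≡k k≤n)

module JohnsonGraph (n k : ℕ) where

  Vertex : Set
  Vertex = V (Johnson n k)

  common : Vertex → Vertex → ℕ
  common A B = ∣ proj₁ A ∩ proj₁ B ∣

  common-comm : ∀ A B → common A B ≡ common B A
  common-comm A B = cong ∣_∣ (∩-comm (proj₁ A) (proj₁ B))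

  common-self : ∀ A → common A A ≡ k
  common-self (p , ∣p∣≡k) = trans (cong ∣_∣ (∩-idem p)) ∣p∣≡k

  common≥k⇒≡ : ∀ {A B} → k ≤ common A B → A ≡ B
  common≥k⇒≡ {p , ∣p∣≡k} {q , ∣q∣≡k} k≤∣p∩q∣ = Σ-≡,≡→≡ (p≡q , ≡-irrelevant _ _)
    where
    ∣p∩q∣≡k : ∣ p ∩ q ∣ ≡ k
    ∣p∩q∣≡k = ≤-antisym (subst (∣ p ∩ q ∣ ≤_) ∣p∣≡k (∣p∩q∣≤∣p∣ p q)) k≤∣p∩q∣
    p≡q : p ≡ q
    p≡q = ⊆-antisym (∣p∩q∣≡∣p∣⇒p⊆q (trans ∣p∩q∣≡k (sym ∣p∣≡k)))
                    (∣p∩q∣≡∣p∣⇒p⊆q (trans (cong ∣_∣ (∩-comm q p)) (trans ∣p∩q∣≡k (sym ∣q∣≡k))))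

  common-adj : ∀ A W X → Adj (Johnson n k) A W → common W X ≤ suc (common A X)
  common-adj A W X A~W = +-cancelʳ-≤ (k ∸ 1) _ _ (begin
    common W X + (k ∸ 1)      ≡⟨ cong (common W X +_) A~W ⟨
    common W X + common A W   ≤⟨ ∣q∩r∣+∣p∩q∣≤∣p∩r∣+∣q∣ (proj₁ A) (proj₁ W) (proj₁ X) ⟩
    common A X + ∣ proj₁ W ∣  ≡⟨ cong (common A X +_) (proj₂ W) ⟩
    common A X + k            ≤⟨ +-monoʳ-≤ (common A X) (m≤n+m∸n k 1) ⟩
    common A X + suc (k ∸ 1)  ≡⟨ +-suc (common A X) (k ∸ 1) ⟩
    suc (common A X) + (k ∸ 1) ∎)
    where open ≤-Reasoning

  common-move : ∀ A W X → Move (Johnson n k) A W → common W X ≤ suc (common A X)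
  common-move A .A X (inj₁ refl) = n≤1+n (common A X)
  common-move A W  X (inj₂ A~W)  = common-adj A W X A~W

  Within⇒k≤common+r : ∀ {r A X} → Within (Johnson n k) r A X → k ≤ common A X + r
  Within⇒k≤common+r {r} {A} here = ≤-trans (≤-reflexive (sym (common-self A))) (m≤m+n _ r)
  Within⇒k≤common+r {suc r} {A} {X} (step {w = W} A~W W~X) = begin
    k                       ≤⟨ Within⇒k≤common+r W~X ⟩
    common W X + r          ≤⟨ +-monoˡ-≤ r (common-adj A W X A~W) ⟩
    suc (common A X) + r    ≡⟨ +-suc (common A X) r ⟨
    common A X + suc r      ∎
    where open ≤-Reasoning

  module _ (A : Vertex) {x y : Fin n} (x∈A : x ∈ proj₁ A) (y∉A : y ∉ proj₁ A) where

    exchanged : Vertex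
    exchanged = exchange (proj₁ A) x y , trans (∣exchange∣ x∈A y∉A) (proj₂ A)

    common-exchanged-away : ∀ C → x ∈ proj₁ C → y ∉ proj₁ C →
                            suc (common exchanged C) ≡ common A C
    common-exchanged-away C x∈C y∉C = begin
      suc (common exchanged C)                  ≡⟨ +-comm 1 (common exchanged C) ⟩
      common exchanged C + 1                    ≡⟨ cong (common exchanged C +_) (∣⁅x⁆∩p∣≡1 x∈C) ⟨
      common exchanged C + ∣ ⁅ x ⁆ ∩ proj₁ C ∣  ≡⟨ ∣exchange∩q∣ x∈A y∉A (proj₁ C) ⟩
      common A C + ∣ ⁅ y ⁆ ∩ proj₁ C ∣          ≡⟨ cong (common A C +_) (∣⁅x⁆∩p∣≡0 y∉C) ⟩
      common A C + 0                            ≡⟨ +-identityʳ (common A C) ⟩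
      common A C                                ∎
      where open ≡-Reasoning

    common-exchanged-toward : ∀ B → x ∉ proj₁ B → y ∈ proj₁ B →
                              common exchanged B ≡ suc (common A B)
    common-exchanged-toward B x∉B y∈B = begin
      common exchanged B                        ≡⟨ +-identityʳ (common exchanged B) ⟨
      common exchanged B + 0                    ≡⟨ cong (common exchanged B +_) (∣⁅x⁆∩p∣≡0 x∉B) ⟨
      common exchanged B + ∣ ⁅ x ⁆ ∩ proj₁ B ∣  ≡⟨ ∣exchange∩q∣ x∈A y∉A (proj₁ B) ⟩
      common A B + ∣ ⁅ y ⁆ ∩ proj₁ B ∣          ≡⟨ cong (common A B +_) (∣⁅x⁆∩p∣≡1 y∈B) ⟩
      common A B + 1                            ≡⟨ +-comm (common A B) 1 ⟩
      suc (common A B)                          ∎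
      where open ≡-Reasoning

    exchanged-adj : Adj (Johnson n k) A exchanged
    exchanged-adj = trans (common-comm A exchanged)
                          (cong (_∸ 1) (trans (common-exchanged-away A x∈A y∉A) (common-self A)))

  closer-neighbour : ∀ A B → common A B < k →
    ∃ λ W → Adj (Johnson n k) A W × common W B ≡ suc (common A B)
  closer-neighbour A@(p , ∣p∣≡k) B@(q , ∣q∣≡k) ∣p∩q∣<k =
    let x , x∈p , x∉q = ∣p∩q∣<∣p∣⇒∃x∈p∧x∉q p q (subst (∣ p ∩ q ∣ <_) (sym ∣p∣≡k) ∣p∩q∣<k)
        y , y∈q , y∉p = ∣p∩q∣<∣p∣⇒∃x∈p∧x∉q q p (subst₂ _<_ (common-comm A B) (sym ∣q∣≡k) ∣p∩q∣<k)
    in exchanged A x∈p y∉p , exchanged-adj A x∈p y∉p , common-exchanged-toward A x∈p y∉p B x∉q y∈q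

  k≤common+r⇒Within : ∀ r {A B} → k ≤ common A B + r → Within (Johnson n k) r A B
  k≤common+r⇒Within r {A} {B} k≤common+r with k ≤? common A B
  k≤common+r⇒Within r       {A} {B} _          | yes k≤common =
    subst (Within (Johnson n k) r A) (common≥k⇒≡ k≤common) here
  k≤common+r⇒Within zero    {A} {B} k≤common+0 | no k≰common =
    contradiction (subst (k ≤_) (+-identityʳ _) k≤common+0) k≰common
  k≤common+r⇒Within (suc r) {A} {B} k≤common+r | no k≰common
    with W , A~W , common-W ← closer-neighbour A B (≰⇒> k≰common)
    = step {w = W} A~W (k≤common+r⇒Within r (subst (k ≤_) common-shift k≤common+r))
    where
    common-shift : common A B + suc r ≡ common W B + r
    common-shift = trans (+-suc (common A B) r) (cong (_+ r) (sym common-W))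

  ecc≤k : ∀ A → EccLe (Johnson n k) A k
  ecc≤k A B = k≤common+r⇒Within k (m≤n+m k (common A B))

  module _ (2k≤n : 2 * k ≤ n) where

    outside-both : ∀ A B → 0 < common A B → ∃ λ y → y ∉ proj₁ A × y ∉ proj₁ B
    outside-both (p , ∣p∣≡k) (q , ∣q∣≡k) 0<∣p∩q∣ =
      let y , y∉p∪q = ∣p∣<n⇒∃x∉p (p ∪ q) ∣p∪q∣<n
      in  y , y∉p∪q ∘ x∈p∪q⁺ ∘ inj₁ , y∉p∪q ∘ x∈p∪q⁺ ∘ inj₂
      where
      ∣p∪q∣<n : ∣ p ∪ q ∣ < n
      ∣p∪q∣<n = begin-strict
        ∣ p ∪ q ∣               <⟨ m<m+n _ 0<∣p∩q∣ ⟩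
        ∣ p ∪ q ∣ + ∣ p ∩ q ∣   ≡⟨ ∣p∪q∣+∣p∩q∣≡∣p∣+∣q∣ p q ⟩
        ∣ p ∣ + ∣ q ∣           ≡⟨ cong₂ _+_ ∣p∣≡k (trans ∣q∣≡k (sym (+-identityʳ k))) ⟩
        2 * k                   ≤⟨ 2k≤n ⟩
        n                       ∎
        where open ≤-Reasoning

    farther-neighbour : ∀ C X {j} → common C X ≡ suc j →
      ∃ λ X′ → Adj (Johnson n k) X X′ × common C X′ ≡ j
    farther-neighbour C X {j} common≡1+j =
      let x , x∈X , x∈C = 0<∣p∩q∣⇒∃x∈p∧x∈q (proj₁ X) (proj₁ C) 0<common
          y , y∉X , y∉C = outside-both X C 0<common
          X′ = exchanged X x∈X y∉X
      in X′ , exchanged-adj X x∈X y∉X , suc-injective (begin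
        suc (common C X′)  ≡⟨ cong suc (common-comm C X′) ⟩
        suc (common X′ C)  ≡⟨ common-exchanged-away X x∈X y∉X C x∈C y∉C ⟩
        common X C         ≡⟨ X∩C≡1+j ⟩
        suc j              ∎)
      where
      open ≡-Reasoning
      X∩C≡1+j : common X C ≡ suc j
      X∩C≡1+j = trans (common-comm X C) common≡1+j
      0<common : 0 < common X C
      0<common = subst (0 <_) (sym X∩C≡1+j) z<s

    ∃-disjoint : ∀ C → ∃ λ X → common C X ≡ 0
    ∃-disjoint C = descend k C (common-self C)
      where
      descend : ∀ j X → common C X ≡ j → ∃ λ X′ → common C X′ ≡ 0
      descend zero    X C∩X≡0   = X , C∩X≡0
      descend (suc j) X C∩X≡1+j =
        let X′ , _ , C∩X′≡j = farther-neighbour C X C∩X≡1+j in descend j X′ C∩X′≡j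

    EccLe⇒k≤ : ∀ {A r} → EccLe (Johnson n k) A r → k ≤ r
    EccLe⇒k≤ {A} {r} ecc =
      let X , A∩X≡0 = ∃-disjoint A in subst (λ m → k ≤ m + r) A∩X≡0 (Within⇒k≤common+r (ecc X))

    ¬CWRC : ∀ {r} → 2 + r ≤ k → ¬ CWRC r (Johnson n k)
    ¬CWRC {r} 2+r≤k (c , wins) =
      let x , c∩x≡0 = ∃-disjoint c in Safe⇒¬CopWins Disjoint far reply c∩x≡0 (wins x)
      where
      Disjoint : Vertex → Vertex → Set
      Disjoint c x = common c x ≡ 0

      common≤1 : ∀ c x c′ → Disjoint c x → Move (Johnson n k) c c′ → common c′ x ≤ 1
      common≤1 c x c′ c∩x≡0 c→c′ = subst (λ m → common c′ x ≤ suc m) c∩x≡0 (common-move c c′ x c→c′)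

      far : ∀ {c x c′} → Disjoint c x → Move (Johnson n k) c c′ → ¬ Within (Johnson n k) r c′ x
      far {c} {x} {c′} c∩x≡0 c→c′ c′~x = n≮n (suc r) (begin-strict
        suc r                  <⟨ 2+r≤k ⟩
        k                      ≤⟨ Within⇒k≤common+r c′~x ⟩
        common c′ x + r        ≤⟨ +-monoˡ-≤ r (common≤1 c x c′ c∩x≡0 c→c′) ⟩
        suc r                  ∎)
        where open ≤-Reasoning

      reply : ∀ {c x c′} → Disjoint c x → Move (Johnson n k) c c′ →
              ∃ λ x′ → Move (Johnson n k) x x′ × Disjoint c′ x′
      reply {c} {x} {c′} c∩x≡0 c→c′ with common c′ x in c′∩x≡m | common≤1 c x c′ c∩x≡0 c→c′
      ... | zero        | _ = x , inj₁ refl , c′∩x≡m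
      ... | suc zero    | _ =
        let x′ , x~x′ , c′∩x′≡0 = farther-neighbour c′ x c′∩x≡m in x′ , inj₂ x~x′ , c′∩x′≡0
      ... | suc (suc _) | s≤s ()

corollary4p5 : (n k : ℕ) → 1 ≤ n → 1 ≤ k → 2 * k ≤ n →
    IsRc (Johnson n k) (k ∸ 1) × IsRadius (Johnson n k) k
corollary4p5 n zero    _ () _
corollary4p5 n (suc k) _ _  2k≤n =
  (EccLe-suc⇒CWRC (ecc≤k v₀) , rc-minimal) , (v₀ , ecc≤k v₀) , λ _ _ → EccLe⇒k≤ 2k≤n
  where
  open JohnsonGraph n (suc k)
  v₀ : Vertex
  v₀ = ∃∣p∣≡k (≤-trans (m≤m+n (suc k) _) 2k≤n)
  rc-minimal : (r : ℕ) → CWRC r (Johnson n (suc k)) → k ≤ r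
  rc-minimal r cwrc = ≮⇒≥ λ r<k → ¬CWRC 2k≤n (s≤s r<k) cwrc
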